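{- Let $G=(V,E)$ be a directed acyclic graph with $V=\{v_1,\dots,v_n\}$ listed in a topological order, and let $E=E_1\cup E_2$ be an edge split of $G$ such that $E_1$ is thin. Let $u,v\in V$, and for $1\le i\le n$ let $\mathcal{P}_i$ be the family of all paths from $u$ to $v_i$ using only edges of $E_1$, $\mathcal{Q}_i$ the family of all paths from $v_i$ to $v$ using only edges of $E_2$, and $\mathcal{S}$ the family of all paths from $u$ to $v$ in $G$. Let $X=\bigoplus_{i=1}^{n}\big(\mathrm{repr}_L(\mathcal{P}_i)\otimes\mathrm{repr}_R(\mathcal{Q}_i)\big)$. Then: (a) $X=(\bot,\bot)$ if and only if $\mathrm{repr}_R(\mathcal{S})=\bot$; (b) if $X=(e_1,\top)$ with $e_1\in E$ then $\mathrm{repr}_R(\mathcal{S})=e_1$; (c) if $X=(\top,e_2)$ with $e_2\in E$ then $\mathrm{repr}_R(\mathcal{S})=e_2$; (d) if $X=(e_1,e_2)$ with $e_1,e_2\in E$ then $\mathrm{repr}_R(\mathcal{S})=e_2$; (e) $X=(\top,\top)$ if and only if $\mathrm{repr}_R(\mathcal{S})=\top$.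
   Context: A path is a sequence of vertices $w_1,\dots,w_k$ with $(w_j,w_{j+1})\in E$ for all $j$; it is identified with its set of edges, and for every vertex there is a path of length $0$ from it to itself. An edge split of $G$ is a partition $E=E_1\cup E_2$ such that there are no vertices $x,y,z$ with $(x,y)\in E_2$ and $(y,z)\in E_1$. An edge set $E'\subseteq E$ is thin if there are no vertices $x,y,z$ with $(x,y)\in E'$ and $(y,z)\in E'$. Let $E^+=E\cup\{\top,\bot\}$. For a family $\mathcal{P}$ of paths with common endpoints: $\mathrm{repr}_L(\mathcal{P})=\bot$ if $\mathcal{P}=\emptyset$, $=\top$ if $\mathcal{P}\neq\emptyset$ and no edge lies on all its paths, and otherwise is the edge lying on all paths of $\mathcal{P}$ whose tail is minimum in the topological order; $\mathrm{repr}_R$ is the same with "maximum". Operations: for $a,b\in E^+$, $a\otimes b=(\bot,\bot)$ if $a=\bot$ or $b=\bot$, else $(a,b)$. On $E^+$: $a\oplus\bot=\bot\oplus a=a$, $a\oplus\top=\top\oplus a=\top$, and for $e,e'\in E$: $e\oplus e'=e$ if $e=e'$, else $\top$. On pairs, $(a_1,b_1)\oplus(a_2,b_2)=(a_1\oplus a_2,b_1\oplus b_2)$; $\bigoplus$ is the iterated operation. -}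

module Defs where

open import Data.Nat using (ℕ)
open import Data.Fin using (Fin; zero; suc; _≤_; _<_; _≟_)
open import Data.Bool using (Bool; true; false; _∨_)
open import Data.Product using (_×_; _,_)
open import Data.Empty using (⊥)
open import Relation.Nullary using (¬_; yes; no)
open import Relation.Binary.PropositionalEquality using (_≡_)

-- Vertices are Fin n, listed in topological order (index order).
-- An edge set is a Boolean relation on Fin n: (x , y) ∈ E  iff  E x y ≡ true.
EdgeSet : ℕ → Set
EdgeSet n = Fin n → Fin n → Bool

_∪_ : ∀ {n} → EdgeSet n → EdgeSet n → EdgeSet n
(A ∪ B) x y = A x y ∨ B x y

Topological : ∀ {n} → EdgeSet n → Set
Topological E = ∀ x y → E x y ≡ true → x < y

Disjoint : ∀ {n} → EdgeSet n → EdgeSet n → Set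
Disjoint A B = ∀ x y → A x y ≡ true → B x y ≡ true → ⊥

EdgeSplit : ∀ {n} → EdgeSet n → EdgeSet n → Set
EdgeSplit E₁ E₂ =
  Disjoint E₁ E₂ × (∀ x y z → E₂ x y ≡ true → E₁ y z ≡ true → ⊥)

Thin : ∀ {n} → EdgeSet n → Set
Thin A = ∀ x y z → A x y ≡ true → A y z ≡ true → ⊥

data Path {n} (R : EdgeSet n) : Fin n → Fin n → Set where
  []  : ∀ {x} → Path R x x
  _∷_ : ∀ {x y z} → R x y ≡ true → Path R y z → Path R x z

data OnPath {n} {R : EdgeSet n} (a b : Fin n) : ∀ {x z} → Path R x z → Set where
  here  : ∀ {z} {e : R a b ≡ true} {p : Path R b z} → OnPath a b (e ∷ p)
  there : ∀ {x y z} {e : R x y ≡ true} {p : Path R y z} →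
          OnPath a b p → OnPath a b (e ∷ p)

OnAll : ∀ {n} → EdgeSet n → Fin n → Fin n → Fin n → Fin n → Set
OnAll R x z a b = (p : Path R x z) → OnPath a b p

-- E⁺ = E ∪ {⊤, ⊥}; an edge is represented by its endpoints (tail , head).
data E⁺ (n : ℕ) : Set where
  ⊤ₑ ⊥ₑ : E⁺ n
  edge : Fin n → Fin n → E⁺ n

-- repr_L of the family of all R-paths from x to z equals r.
IsReprL : ∀ {n} → EdgeSet n → Fin n → Fin n → E⁺ n → Set
IsReprL R x z ⊥ₑ = ¬ Path R x z
IsReprL R x z ⊤ₑ = Path R x z × (∀ a b → ¬ OnAll R x z a b)
IsReprL R x z (edge a b) =
  Path R x z × OnAll R x z a b × (∀ c d → OnAll R x z c d → a ≤ c)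

IsReprR : ∀ {n} → EdgeSet n → Fin n → Fin n → E⁺ n → Set
IsReprR R x z ⊥ₑ = ¬ Path R x z
IsReprR R x z ⊤ₑ = Path R x z × (∀ a b → ¬ OnAll R x z a b)
IsReprR R x z (edge a b) =
  Path R x z × OnAll R x z a b × (∀ c d → OnAll R x z c d → c ≤ a)

_⊗_ : ∀ {n} → E⁺ n → E⁺ n → E⁺ n × E⁺ n
⊥ₑ ⊗ b = ⊥ₑ , ⊥ₑ
⊤ₑ ⊗ ⊥ₑ = ⊥ₑ , ⊥ₑ
edge x y ⊗ ⊥ₑ = ⊥ₑ , ⊥ₑ
⊤ₑ ⊗ ⊤ₑ = ⊤ₑ , ⊤ₑ
⊤ₑ ⊗ edge x y = ⊤ₑ , edge x y
edge x y ⊗ ⊤ₑ = edge x y , ⊤ₑ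
edge x y ⊗ edge z w = edge x y , edge z w

_⊕_ : ∀ {n} → E⁺ n → E⁺ n → E⁺ n
⊥ₑ ⊕ b = b
⊤ₑ ⊕ b = ⊤ₑ
edge x y ⊕ ⊥ₑ = edge x y
edge x y ⊕ ⊤ₑ = ⊤ₑ
edge x y ⊕ edge z w with x ≟ z | y ≟ w
... | yes _ | yes _ = edge x y
... | yes _ | no _  = ⊤ₑ
... | no _  | _     = ⊤ₑ

_⊕²_ : ∀ {n} → E⁺ n × E⁺ n → E⁺ n × E⁺ n → E⁺ n × E⁺ n
(a₁ , b₁) ⊕² (a₂ , b₂) = (a₁ ⊕ a₂) , (b₁ ⊕ b₂)

⨁ : ∀ {n m} → (Fin m → E⁺ n × E⁺ n) → E⁺ n × E⁺ n
⨁ {m = ℕ.zero} f = ⊥ₑ , ⊥ₑ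
⨁ {m = ℕ.suc m} f = f zero ⊕² ⨁ (λ i → f (suc i))

module Submission where

-- Since no E₂-edge is followed by an E₁-edge, every u–v path is an E₁-path from u to some
-- vertex i followed by an E₂-path from i to v, and thinness makes the E₁-part either empty
-- or the single edge (u , i).  Call i a contributor when both parts exist; X is then the
-- join, in the flat order ⊥ ⊑ e ⊑ ⊤, of the pairs (repr_L P_i , repr_R Q_i) over the
-- contributors.  If all contributors agree on the edge e = repr_R Q_i, then e lies on every
-- u–v path and, sitting in the E₂-part, has maximal tail.  If X = (e₁ , ⊤), then e₁ = (u , i)
-- for a single contributor i with repr_R Q_i = ⊤, so no later edge is common to all paths.
-- If X = (⊤ , ⊤) but repr_R S were an edge (c , d), every contributor whose E₁-part avoids
-- (c , d) would have repr_R Q_i = (c , d); otherwise c = u and d is the only contributor,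
-- whence repr_L P_d = (u , d).

open import Defs
open import Data.Nat using (ℕ)
import Data.Nat.Properties as ℕ
open import Data.Fin using (Fin; _≤_; _<_; _≟_)
open import Data.Fin.Properties using (_≤?_; ≤-antisym; ≤-reflexive; any?)
open import Data.Bool using (true; false)
open import Data.Bool.Properties using (∨-zeroʳ)
open import Data.Product using (_×_; _,_; proj₁; proj₂; ∃; Σ)
open import Data.Sum using (_⊎_; inj₁; inj₂)
open import Data.Empty using (⊥; ⊥-elim)
open import Function using (case_of_)
open import Function.Bundles using (_⇔_; mk⇔)
open import Relation.Nullary using (¬_; Dec; yes; no)
open import Relation.Binary.PropositionalEquality
  using (_≡_; _≢_; refl; sym; trans; cong; cong₂; subst)

infix 4 _⊑_

data _⊑_ {n} : E⁺ n → E⁺ n → Set where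
  ⊥ₑ⊑    : ∀ {x} → ⊥ₑ ⊑ x
  ⊑⊤ₑ    : ∀ {x} → x ⊑ ⊤ₑ
  ⊑-refl : ∀ {x} → x ⊑ x

module _ {n : ℕ} where

  ⊑-reflexive : {x y : E⁺ n} → x ≡ y → x ⊑ y
  ⊑-reflexive refl = ⊑-refl

  ⊑-trans : {x y z : E⁺ n} → x ⊑ y → y ⊑ z → x ⊑ z
  ⊑-trans ⊥ₑ⊑    _      = ⊥ₑ⊑
  ⊑-trans _      ⊑⊤ₑ    = ⊑⊤ₑ
  ⊑-trans ⊑-refl q      = q
  ⊑-trans ⊑⊤ₑ    ⊑-refl = ⊑⊤ₑ

  ⊑-antisym : {x y : E⁺ n} → x ⊑ y → y ⊑ x → x ≡ y
  ⊑-antisym ⊑-refl _      = refl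
  ⊑-antisym _      ⊑-refl = refl
  ⊑-antisym ⊥ₑ⊑    ⊥ₑ⊑    = refl
  ⊑-antisym ⊑⊤ₑ    ⊑⊤ₑ    = refl

  ⊑-edge : {x : E⁺ n} {a b : Fin n} → x ⊑ edge a b → x ≢ ⊥ₑ → x ≡ edge a b
  ⊑-edge ⊥ₑ⊑    x≢⊥ = ⊥-elim (x≢⊥ refl)
  ⊑-edge ⊑-refl _   = refl

  ⊤ₑ⋢edge : {a b : Fin n} → ¬ (⊤ₑ ⊑ edge a b)
  ⊤ₑ⋢edge ()

  ⊕-upperˡ : (x y : E⁺ n) → x ⊑ x ⊕ y
  ⊕-upperˡ ⊥ₑ         y          = ⊥ₑ⊑
  ⊕-upperˡ ⊤ₑ         y          = ⊑⊤ₑ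
  ⊕-upperˡ (edge a b) ⊥ₑ         = ⊑-refl
  ⊕-upperˡ (edge a b) ⊤ₑ         = ⊑⊤ₑ
  ⊕-upperˡ (edge a b) (edge c d) with a ≟ c | b ≟ d
  ... | yes _ | yes _ = ⊑-refl
  ... | yes _ | no _  = ⊑⊤ₑ
  ... | no _  | _     = ⊑⊤ₑ

  ⊕-upperʳ : (x y : E⁺ n) → y ⊑ x ⊕ y
  ⊕-upperʳ ⊥ₑ         y          = ⊑-refl
  ⊕-upperʳ ⊤ₑ         y          = ⊑⊤ₑ
  ⊕-upperʳ (edge a b) ⊥ₑ         = ⊥ₑ⊑
  ⊕-upperʳ (edge a b) ⊤ₑ         = ⊑⊤ₑ
  ⊕-upperʳ (edge a b) (edge c d) with a ≟ c | b ≟ d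
  ... | yes refl | yes refl = ⊑-refl
  ... | yes _    | no _     = ⊑⊤ₑ
  ... | no _     | _        = ⊑⊤ₑ

  ⊕-lub : {x y z : E⁺ n} → x ⊑ z → y ⊑ z → x ⊕ y ⊑ z
  ⊕-lub {⊥ₑ}       _      q      = q
  ⊕-lub {⊤ₑ}       p      _      = p
  ⊕-lub            ⊑⊤ₑ    _      = ⊑⊤ₑ
  ⊕-lub {edge a b} p      ⊥ₑ⊑    = p
  ⊕-lub {edge a b} ⊑-refl ⊑-refl with a ≟ a | b ≟ b
  ... | yes _ | yes _  = ⊑-refl
  ... | yes _ | no b≢b = ⊥-elim (b≢b refl)
  ... | no a≢a | _     = ⊥-elim (a≢a refl)

  infix 4 _⊑²_

  _⊑²_ : E⁺ n × E⁺ n → E⁺ n × E⁺ n → Set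
  p ⊑² q = proj₁ p ⊑ proj₁ q × proj₂ p ⊑ proj₂ q

  ⊑²-refl : {p : E⁺ n × E⁺ n} → p ⊑² p
  ⊑²-refl = ⊑-refl , ⊑-refl

  ⊑²-antisym : {p q : E⁺ n × E⁺ n} → p ⊑² q → q ⊑² p → p ≡ q
  ⊑²-antisym (p₁ , p₂) (q₁ , q₂) = cong₂ _,_ (⊑-antisym p₁ q₁) (⊑-antisym p₂ q₂)

  ⨁-upper : ∀ {m} (f : Fin m → E⁺ n × E⁺ n) i → f i ⊑² ⨁ f
  ⨁-upper f Fin.zero = ⊕-upperˡ _ _ , ⊕-upperˡ _ _
  ⨁-upper f (Fin.suc i) with ⨁-upper (λ j → f (Fin.suc j)) i
  ... | le₁ , le₂ = ⊑-trans le₁ (⊕-upperʳ (proj₁ (f Fin.zero)) _)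
                  , ⊑-trans le₂ (⊕-upperʳ (proj₂ (f Fin.zero)) _)

  ⨁-lub : ∀ {m} {f : Fin m → E⁺ n × E⁺ n} {z} → (∀ i → f i ⊑² z) → ⨁ f ⊑² z
  ⨁-lub {ℕ.zero}  h = ⊥ₑ⊑ , ⊥ₑ⊑
  ⨁-lub {ℕ.suc m} h with h Fin.zero | ⨁-lub (λ i → h (Fin.suc i))
  ... | le₁ , le₂ | ge₁ , ge₂ = ⊕-lub le₁ ge₁ , ⊕-lub le₂ ge₂

  ⊗-≢⊥ : {x y : E⁺ n} → x ≢ ⊥ₑ → y ≢ ⊥ₑ → x ⊗ y ≡ (x , y)
  ⊗-≢⊥ {⊥ₑ}                  x≢⊥ _   = ⊥-elim (x≢⊥ refl)
  ⊗-≢⊥ {_}        {⊥ₑ}       _   y≢⊥ = ⊥-elim (y≢⊥ refl)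
  ⊗-≢⊥ {⊤ₑ}       {⊤ₑ}       _ _ = refl
  ⊗-≢⊥ {⊤ₑ}       {edge _ _} _ _ = refl
  ⊗-≢⊥ {edge _ _} {⊤ₑ}       _ _ = refl
  ⊗-≢⊥ {edge _ _} {edge _ _} _ _ = refl

module _ {n} {R : EdgeSet n} {x z : Fin n} where

  IsReprL-≢⊥ : ∀ {r} → IsReprL R x z r → Path R x z → r ≢ ⊥ₑ
  IsReprL-≢⊥ ¬p p refl = ¬p p

  IsReprR-≢⊥ : ∀ {r} → IsReprR R x z r → Path R x z → r ≢ ⊥ₑ
  IsReprR-≢⊥ ¬p p refl = ¬p p

  IsReprR-¬Path : ∀ {r} → IsReprR R x z r → ¬ Path R x z → r ≡ ⊥ₑ
  IsReprR-¬Path {⊥ₑ}       _       _  = refl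
  IsReprR-¬Path {⊤ₑ}       (p , _) ¬p = ⊥-elim (¬p p)
  IsReprR-¬Path {edge _ _} (p , _) ¬p = ⊥-elim (¬p p)

IsRepr-⊗ : ∀ {n} {R R′ : EdgeSet n} {x y x′ y′ r r′} →
           IsReprL R x y r → IsReprR R′ x′ y′ r′ →
           (Path R x y × Path R′ x′ y′) ⊎ r ⊗ r′ ≡ (⊥ₑ , ⊥ₑ)
IsRepr-⊗ {r = ⊥ₑ}                        _ _ = inj₂ refl
IsRepr-⊗ {r = ⊤ₑ}       {r′ = ⊥ₑ}        _ _ = inj₂ refl
IsRepr-⊗ {r = edge _ _} {r′ = ⊥ₑ}        _ _ = inj₂ refl
IsRepr-⊗ {r = ⊤ₑ}       {r′ = ⊤ₑ}        h h′ = inj₁ (proj₁ h , proj₁ h′)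
IsRepr-⊗ {r = ⊤ₑ}       {r′ = edge _ _}  h h′ = inj₁ (proj₁ h , proj₁ h′)
IsRepr-⊗ {r = edge _ _} {r′ = ⊤ₑ}        h h′ = inj₁ (proj₁ h , proj₁ h′)
IsRepr-⊗ {r = edge _ _} {r′ = edge _ _}  h h′ = inj₁ (proj₁ h , proj₁ h′)

_⊆ₚ_ : ∀ {n} {R R′ : EdgeSet n} {x z x′ z′} → Path R x z → Path R′ x′ z′ → Set
p ⊆ₚ q = ∀ {a b} → OnPath a b p → OnPath a b q

module _ {n} {R : EdgeSet n} where

  infixr 5 _++_

  _++_ : ∀ {x y z} → Path R x y → Path R y z → Path R x z
  []      ++ q = q
  (e ∷ p) ++ q = e ∷ (p ++ q)

  OnPath-++⁻ : ∀ {a b x y z} (p : Path R x y) (q : Path R y z) →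
               OnPath a b (p ++ q) → OnPath a b p ⊎ OnPath a b q
  OnPath-++⁻ []      q ab∈q      = inj₂ ab∈q
  OnPath-++⁻ (e ∷ p) q here      = inj₁ here
  OnPath-++⁻ (e ∷ p) q (there h) with OnPath-++⁻ p q h
  ... | inj₁ ab∈p = inj₁ (there ab∈p)
  ... | inj₂ ab∈q = inj₂ ab∈q

  OnPath-++ˡ : ∀ {x y z} (p : Path R x y) (q : Path R y z) → p ⊆ₚ (p ++ q)
  OnPath-++ˡ (e ∷ p) q here      = here
  OnPath-++ˡ (e ∷ p) q (there h) = there (OnPath-++ˡ p q h)

  OnPath-++ʳ : ∀ {x y z} (p : Path R x y) (q : Path R y z) → q ⊆ₚ (p ++ q)
  OnPath-++ʳ []      q h = h
  OnPath-++ʳ (e ∷ p) q h = there (OnPath-++ʳ p q h)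

  OnPath-edge : ∀ {a b x z} {p : Path R x z} → OnPath a b p → R a b ≡ true
  OnPath-edge (here {e = e}) = e
  OnPath-edge (there h)      = OnPath-edge h

  OnPath-split : ∀ {a b x z} {p : Path R x z} → OnPath a b p →
                 Σ (Path R x a) λ _ → Σ (R a b ≡ true) λ _ → Σ (Path R b z) λ q → q ⊆ₚ p
  OnPath-split (here {e = e} {p = q}) = [] , e , q , there
  OnPath-split (there {e = e} h) with OnPath-split h
  ... | p₁ , e′ , q , q⊆p = e ∷ p₁ , e′ , q , λ k → there (q⊆p k)

module _ {n} {R R′ : EdgeSet n} (R⊆R′ : ∀ {x y} → R x y ≡ true → R′ x y ≡ true) where

  map : ∀ {x z} → Path R x z → Path R′ x z
  map []      = []
  map (e ∷ p) = R⊆R′ e ∷ map p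

  OnPath-map⁺ : ∀ {x z} (p : Path R x z) → p ⊆ₚ map p
  OnPath-map⁺ (e ∷ p) here      = here
  OnPath-map⁺ (e ∷ p) (there h) = there (OnPath-map⁺ p h)

  OnPath-map⁻ : ∀ {x z} (p : Path R x z) → map p ⊆ₚ p
  OnPath-map⁻ (e ∷ p) here      = here
  OnPath-map⁻ (e ∷ p) (there h) = there (OnPath-map⁻ p h)

module _ {n} {R : EdgeSet n} (top : Topological R) where

  Path-≤ : ∀ {x z} → Path R x z → x ≤ z
  Path-≤ []      = ℕ.≤-refl
  Path-≤ (e ∷ p) = ℕ.<⇒≤ (ℕ.<-≤-trans (top _ _ e) (Path-≤ p))

  OnPath-tail< : ∀ {a b x z} {p : Path R x z} → OnPath a b p → a < z
  OnPath-tail< (here {e = e} {p = p}) = ℕ.<-≤-trans (top _ _ e) (Path-≤ p)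
  OnPath-tail< (there h)              = OnPath-tail< h

  OnPath-tail≥ : ∀ {a b x z} {p : Path R x z} → OnPath a b p → x ≤ a
  OnPath-tail≥ here              = ℕ.≤-refl
  OnPath-tail≥ (there {e = e} h) = ℕ.<⇒≤ (ℕ.<-≤-trans (top _ _ e) (OnPath-tail≥ h))

  -- Tails strictly increase along a path, so a tail determines its edge.
  OnPath-head-unique : ∀ {a b d x z} {p : Path R x z} → OnPath a b p → OnPath a d p → b ≡ d
  OnPath-head-unique here             here             = refl
  OnPath-head-unique (here {e = e})   (there h)        =
    ⊥-elim (ℕ.<-irrefl refl (ℕ.<-≤-trans (top _ _ e) (OnPath-tail≥ h)))
  OnPath-head-unique (there h)        (here {e = e})   =
    ⊥-elim (ℕ.<-irrefl refl (ℕ.<-≤-trans (top _ _ e) (OnPath-tail≥ h)))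
  OnPath-head-unique (there h)        (there k)        = OnPath-head-unique h k

  IsReprR-unique : ∀ {x z r r′} → IsReprR R x z r → IsReprR R x z r′ → r ≡ r′
  IsReprR-unique {r = ⊥ₑ}       {⊥ₑ}       _ _ = refl
  IsReprR-unique {r = ⊤ₑ}       {⊤ₑ}       _ _ = refl
  IsReprR-unique {r = ⊥ₑ}       {⊤ₑ}       ¬p (p , _) = ⊥-elim (¬p p)
  IsReprR-unique {r = ⊥ₑ}       {edge _ _} ¬p (p , _) = ⊥-elim (¬p p)
  IsReprR-unique {r = ⊤ₑ}       {⊥ₑ}       (p , _) ¬p = ⊥-elim (¬p p)
  IsReprR-unique {r = edge _ _} {⊥ₑ}       (p , _) ¬p = ⊥-elim (¬p p)
  IsReprR-unique {r = ⊤ₑ}       {edge c d} (_ , none) (_ , on-cd , _) = ⊥-elim (none c d on-cd)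
  IsReprR-unique {r = edge a b} {⊤ₑ}       (_ , on-ab , _) (_ , none) = ⊥-elim (none a b on-ab)
  IsReprR-unique {r = edge a b} {edge c d} (p , on-ab , max) (_ , on-cd , max′)
    with ≤-antisym (max′ a b on-ab) (max c d on-cd)
  ... | refl = cong (edge a) (OnPath-head-unique (on-ab p) (on-cd p))

module _ {n} {A B : EdgeSet n} where

  ∪-inclˡ : ∀ {x y} → A x y ≡ true → (A ∪ B) x y ≡ true
  ∪-inclˡ e rewrite e = refl

  ∪-inclʳ : ∀ {x y} → B x y ≡ true → (A ∪ B) x y ≡ true
  ∪-inclʳ {x} {y} e rewrite e = ∨-zeroʳ (A x y)

  ∪-cases : ∀ {x y} → (A ∪ B) x y ≡ true → A x y ≡ true ⊎ B x y ≡ true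
  ∪-cases {x} {y} e with A x y
  ... | true  = inj₁ refl
  ... | false = inj₂ e

  Topological-∪ˡ : Topological (A ∪ B) → Topological A
  Topological-∪ˡ top x y e = top x y (∪-inclˡ e)

  Topological-∪ʳ : Topological (A ∪ B) → Topological B
  Topological-∪ʳ top x y e = top x y (∪-inclʳ e)

module _ {n} {A : EdgeSet n} (thin : Thin A) where

  thin-OnPath : ∀ {a b x i} (p : Path A x i) → OnPath a b p → a ≡ x × b ≡ i
  thin-OnPath (e ∷ [])       here = refl , refl
  thin-OnPath (e ∷ (e′ ∷ p)) _    = ⊥-elim (thin _ _ _ e e′)

  thin-Path : ∀ {x i} → Path A x i → x ≡ i ⊎ A x i ≡ true
  thin-Path []             = inj₁ refl
  thin-Path (e ∷ [])       = inj₂ e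
  thin-Path (e ∷ (e′ ∷ p)) = ⊥-elim (thin _ _ _ e e′)

  thin-OnAll : Topological A → ∀ {x i} → A x i ≡ true → OnAll A x i x i
  thin-OnAll top e []             = ⊥-elim (ℕ.<-irrefl refl (top _ _ e))
  thin-OnAll top e (e′ ∷ [])      = here
  thin-OnAll top e (e′ ∷ (e″ ∷ p)) = ⊥-elim (thin _ _ _ e′ e″)

module Split {n} (A B : EdgeSet n) (top : Topological (A ∪ B))
             (no-BA : ∀ x y z → B x y ≡ true → A y z ≡ true → ⊥) where

  E : EdgeSet n
  E = A ∪ B

  topB : Topological B
  topB = Topological-∪ʳ {A = A} top

  A⊆E : ∀ {x y} → A x y ≡ true → E x y ≡ true
  A⊆E = ∪-inclˡ {A = A} {B}

  B⊆E : ∀ {x y} → B x y ≡ true → E x y ≡ true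
  B⊆E = ∪-inclʳ {A = A} {B}

  infixr 5 _⋈_

  _⋈_ : ∀ {x y z} → Path A x y → Path B y z → Path E x z
  p ⋈ q = map A⊆E p ++ map B⊆E q

  OnPath-⋈⁻ : ∀ {a b x y z} (p : Path A x y) (q : Path B y z) →
              OnPath a b (p ⋈ q) → OnPath a b p ⊎ OnPath a b q
  OnPath-⋈⁻ p q h with OnPath-++⁻ (map A⊆E p) (map B⊆E q) h
  ... | inj₁ k = inj₁ (OnPath-map⁻ A⊆E p k)
  ... | inj₂ k = inj₂ (OnPath-map⁻ B⊆E q k)

  OnPath-⋈ˡ : ∀ {x y z} (p : Path A x y) (q : Path B y z) → p ⊆ₚ (p ⋈ q)
  OnPath-⋈ˡ p q h = OnPath-++ˡ _ (map B⊆E q) (OnPath-map⁺ A⊆E p h)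

  OnPath-⋈ʳ : ∀ {x y z} (p : Path A x y) (q : Path B y z) → q ⊆ₚ (p ⋈ q)
  OnPath-⋈ʳ p q h = OnPath-++ʳ (map A⊆E p) _ (OnPath-map⁺ B⊆E q h)

  decompose : ∀ {x z} (r : Path E x z) →
              ∃ λ i → Σ (Path A x i) λ p → Σ (Path B i z) λ q → (p ⋈ q) ⊆ₚ r
  decompose [] = _ , [] , [] , λ ()
  decompose (e ∷ r) with decompose r | ∪-cases {A = A} {B} e
  ... | i , p , q , t      | inj₁ eA = i , eA ∷ p , q , λ { here → here ; (there h) → there (t h) }
  ... | i , [] , q , t     | inj₂ eB = _ , [] , eB ∷ q , λ { here → here ; (there h) → there (t h) }
  ... | i , e′ ∷ p , q , t | inj₂ eB = ⊥-elim (no-BA _ _ _ eB e′)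

  B-tail : ∀ {a b z} → B a b ≡ true → (r : Path E b z) → Σ (Path B b z) λ r′ → r′ ⊆ₚ r
  B-tail eB [] = [] , λ ()
  B-tail eB (e ∷ r) with ∪-cases {A = A} {B} e
  ... | inj₁ eA = ⊥-elim (no-BA _ _ _ eB eA)
  ... | inj₂ eB′ with B-tail eB′ r
  ... | r′ , r′⊆r = eB′ ∷ r′ , λ { here → here ; (there h) → there (r′⊆r h) }

  OnAll-decomposed : ∀ {u v a b} →
    (∀ {i} (p : Path A u i) (q : Path B i v) → OnPath a b (p ⋈ q)) → OnAll E u v a b
  OnAll-decomposed h r with decompose r
  ... | _ , p , q , p⋈q⊆r = p⋈q⊆r (h p q)

  OnAll-suffix : ∀ {u i v c d} → OnAll E u v c d →
                 (p : Path A u i) → ¬ OnPath c d p → OnAll B i v c d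
  OnAll-suffix on-cd p cd∉p q with OnPath-⋈⁻ p q (on-cd (p ⋈ q))
  ... | inj₁ cd∈p = ⊥-elim (cd∉p cd∈p)
  ... | inj₂ cd∈q = cd∈q

  -- Every E-path through (c , d) continues in B, so it can be grafted onto the B-path q.
  OnAll-beyond : ∀ {u i v a b c d} → OnAll E u v c d → (q : Path B i v) → OnPath c d q →
                 OnAll B i v a b → c ≤ a → OnAll E u v a b
  OnAll-beyond on-cd q cd∈q on-ab c≤a r
    with OnPath-split (on-cd r) | OnPath-split cd∈q
  ... | _ , _ , r₂ , r₂⊆r | q₁ , eB , _ , _ with B-tail eB r₂
  ... | r₂′ , r₂′⊆r₂ with OnPath-++⁻ q₁ (eB ∷ r₂′) (on-ab (q₁ ++ (eB ∷ r₂′)))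
  ... | inj₁ ab∈q₁         = ⊥-elim (ℕ.<⇒≱ (OnPath-tail< topB ab∈q₁) c≤a)
  ... | inj₂ here          = on-cd r
  ... | inj₂ (there ab∈r₂′) = r₂⊆r (r₂′⊆r₂ ab∈r₂′)

  IsReprR-suffix : ∀ {u i v c d} → IsReprR E u v (edge c d) →
                   Path B i v → OnAll B i v c d → IsReprR B i v (edge c d)
  IsReprR-suffix {c = c} (_ , on-cd , max) q on-cdB = q , on-cdB , bound
    where
    bound : ∀ a b → OnAll _ _ _ a b → a ≤ c
    bound a b on-ab with a ≤? c
    ... | yes a≤c = a≤c
    ... | no a≰c  = max a b (OnAll-beyond on-cd q (on-cdB q) on-ab (ℕ.<⇒≤ (ℕ.≰⇒> a≰c)))

module Contribution {n} (E₁ E₂ : EdgeSet n) (top : Topological (E₁ ∪ E₂))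
  (split : EdgeSplit E₁ E₂) (thin : Thin E₁) (u v : Fin n) (rP rQ : Fin n → E⁺ n)
  (hP : ∀ i → IsReprL E₁ u i (rP i)) (hQ : ∀ i → IsReprR E₂ i v (rQ i)) where

  open Split E₁ E₂ top (proj₂ split) public

  top₁ : Topological E₁
  top₁ = Topological-∪ˡ {B = E₂} top

  Contributor : Fin n → Set
  Contributor i = Path E₁ u i × Path E₂ i v

  X : E⁺ n × E⁺ n
  X = ⨁ (λ i → rP i ⊗ rQ i)

  rP-≢⊥ : ∀ {i} → Contributor i → rP i ≢ ⊥ₑ
  rP-≢⊥ (p , _) = IsReprL-≢⊥ (hP _) p

  rQ-≢⊥ : ∀ {i} → Contributor i → rQ i ≢ ⊥ₑ
  rQ-≢⊥ (_ , q) = IsReprR-≢⊥ (hQ _) q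

  ⊗-contr : ∀ {i} → Contributor i → rP i ⊗ rQ i ≡ (rP i , rQ i)
  ⊗-contr c = ⊗-≢⊥ (rP-≢⊥ c) (rQ-≢⊥ c)

  Contributor? : ∀ i → Dec (Contributor i)
  Contributor? i with IsRepr-⊗ (hP i) (hQ i)
  ... | inj₁ c   = yes c
  ... | inj₂ ⊗≡⊥ = no λ c → rP-≢⊥ c (cong proj₁ (trans (sym (⊗-contr c)) ⊗≡⊥))

  X-upper : ∀ {i} → Contributor i → (rP i , rQ i) ⊑² X
  X-upper {i} c = subst (_⊑² X) (⊗-contr c) (⨁-upper (λ j → rP j ⊗ rQ j) i)

  X-lub : ∀ {z} → (∀ {i} → Contributor i → (rP i , rQ i) ⊑² z) → X ⊑² z
  X-lub {z} h = ⨁-lub bound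
    where
    bound : ∀ i → rP i ⊗ rQ i ⊑² z
    bound i with IsRepr-⊗ (hP i) (hQ i)
    ... | inj₁ c   = subst (_⊑² z) (sym (⊗-contr c)) (h c)
    ... | inj₂ ⊗≡⊥ = subst (_⊑² z) (sym ⊗≡⊥) (⊥ₑ⊑ , ⊥ₑ⊑)

  X-⊑ : ∀ {i x y} → X ≡ (x , y) → Contributor i → rP i ⊑ x × rQ i ⊑ y
  X-⊑ X≡ c = subst (_ ⊑²_) X≡ (X-upper c)

  X-unique : ∀ {j} → Contributor j → (∀ {i} → Contributor i → i ≡ j) → X ≡ (rP j , rQ j)
  X-unique cj only-j = ⊑²-antisym (X-lub bound) (X-upper cj)
    where
    bound : ∀ {i} → Contributor i → (rP i , rQ i) ⊑² _
    bound ci with only-j ci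
    ... | refl = ⊑²-refl

  ¬Path⇒X≡⊥ : ¬ Path E u v → X ≡ (⊥ₑ , ⊥ₑ)
  ¬Path⇒X≡⊥ ¬r = ⊑²-antisym (X-lub λ (p , q) → ⊥-elim (¬r (p ⋈ q))) (⊥ₑ⊑ , ⊥ₑ⊑)

  X≡⊥ˡ⇒¬Path : ∀ {y} → X ≡ (⊥ₑ , y) → ¬ Path E u v
  X≡⊥ˡ⇒¬Path X≡ r with decompose r
  ... | _ , p , q , _ = rP-≢⊥ (p , q) (⊑-antisym (proj₁ (X-⊑ X≡ (p , q))) ⊥ₑ⊑)

  X≡⊥ʳ⇒¬Path : ∀ {x} → X ≡ (x , ⊥ₑ) → ¬ Path E u v
  X≡⊥ʳ⇒¬Path X≡ r with decompose r
  ... | _ , p , q , _ = rQ-≢⊥ (p , q) (⊑-antisym (proj₂ (X-⊑ X≡ (p , q))) ⊥ₑ⊑)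

  contributor : X ≢ (⊥ₑ , ⊥ₑ) → ∃ Contributor
  contributor X≢⊥ with any? Contributor?
  ... | yes c  = c
  ... | no ¬c  = ⊥-elim (X≢⊥ (⊑²-antisym (X-lub λ c → ⊥-elim (¬c (_ , c))) (⊥ₑ⊑ , ⊥ₑ⊑)))

  IsReprR-of-X₂ : ∀ {x a b} → X ≡ (x , edge a b) → IsReprR E u v (edge a b)
  IsReprR-of-X₂ {a = a} {b} X≡ with contributor (λ X≡⊥ → case trans (sym X≡) X≡⊥ of λ ())
  ... | j , p , q = p ⋈ q , OnAll-decomposed on-q , max
    where
    hQ′ : ∀ {i} → Contributor i → IsReprR E₂ i v (edge a b)
    hQ′ c = subst (IsReprR E₂ _ v) (⊑-edge (proj₂ (X-⊑ X≡ c)) (rQ-≢⊥ c)) (hQ _)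

    on-q : ∀ {i} (p′ : Path E₁ u i) (q′ : Path E₂ i v) → OnPath a b (p′ ⋈ q′)
    on-q p′ q′ = OnPath-⋈ʳ p′ q′ (proj₁ (proj₂ (hQ′ (p′ , q′))) q′)

    max : ∀ c d → OnAll E u v c d → c ≤ a
    max c d on-cd with c ≤? a
    ... | yes c≤a = c≤a
    ... | no c≰a  = proj₂ (proj₂ (hQ′ (p , q))) c d (OnAll-suffix on-cd p cd∉p)
      where
      cd∉p : ¬ OnPath c d p
      cd∉p cd∈p = c≰a (ℕ.<⇒≤ (ℕ.<-≤-trans (OnPath-tail< top₁ cd∈p)
                    (OnPath-tail≥ topB (proj₁ (proj₂ (hQ′ (p , q))) q))))

  IsReprR-of-X₁ : ∀ {a b} → X ≡ (edge a b , ⊤ₑ) → IsReprR E u v (edge a b)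
  IsReprR-of-X₁ {a} {b} X≡ with contributor (λ X≡⊥ → case trans (sym X≡) X≡⊥ of λ ())
  ... | j , p , q = p ⋈ q , OnAll-decomposed on-p , max
    where
    hP′ : ∀ {i} → Contributor i → IsReprL E₁ u i (edge a b)
    hP′ c = subst (IsReprL E₁ u _) (⊑-edge (proj₁ (X-⊑ X≡ c)) (rP-≢⊥ c)) (hP _)

    on-p : ∀ {i} (p′ : Path E₁ u i) (q′ : Path E₂ i v) → OnPath a b (p′ ⋈ q′)
    on-p p′ q′ = OnPath-⋈ˡ p′ q′ (proj₁ (proj₂ (hP′ (p′ , q′))) p′)

    ends : ∀ {i} → Contributor i → a ≡ u × b ≡ i
    ends (p′ , q′) = thin-OnPath thin p′ (proj₁ (proj₂ (hP′ (p′ , q′))) p′)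

    rQj≡⊤ : rQ j ≡ ⊤ₑ
    rQj≡⊤ = cong proj₂ (trans (sym (X-unique (p , q) only-j)) X≡)
      where
      only-j : ∀ {i} → Contributor i → i ≡ j
      only-j c = trans (sym (proj₂ (ends c))) (proj₂ (ends (p , q)))

    max : ∀ c d → OnAll E u v c d → c ≤ a
    max c d on-cd with c ≤? a
    ... | yes c≤a = c≤a
    ... | no c≰a  = ⊥-elim (proj₂ (subst (IsReprR E₂ j v) rQj≡⊤ (hQ j)) c d
                              (OnAll-suffix on-cd p cd∉p))
      where
      cd∉p : ¬ OnPath c d p
      cd∉p cd∈p = c≰a (≤-reflexive (trans (proj₁ (thin-OnPath thin p cd∈p))
                                          (sym (proj₁ (ends (p , q))))))

  X₂-⊑ : ∀ {e} → (∀ {i} → Contributor i → rQ i ⊑ e) → proj₂ X ⊑ e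
  X₂-⊑ h = proj₂ (X-lub λ c → ⊑⊤ₑ , h c)

  rQ≡repr : ∀ {c d i} → IsReprR E u v (edge c d) →
            (ci : Contributor i) → ¬ OnPath c d (proj₁ ci) → rQ i ≡ edge c d
  rQ≡repr hS (p , q) cd∉p =
    IsReprR-unique topB (hQ _) (IsReprR-suffix hS q (OnAll-suffix (proj₁ (proj₂ hS)) p cd∉p))

  ¬IsReprR-first-edge : ∀ {d} → X ≡ (⊤ₑ , ⊤ₑ) → IsReprR E u v (edge u d) → ¬ Contributor d
  ¬IsReprR-first-edge {d} X≡ hS cd with thin-Path thin (proj₁ cd)
  ... | inj₁ refl  = ℕ.<-irrefl refl (top _ _ (OnPath-edge (proj₁ (proj₂ hS) (proj₁ hS))))
  ... | inj₂ ud∈E₁ = proj₂ (subst (IsReprL E₁ u d) rPd≡⊤ (hP d)) u d (thin-OnAll thin top₁ ud∈E₁)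
    where
    only-d : ∀ {i} → Contributor i → i ≡ d
    only-d {i} ci with d ≟ i
    ... | yes d≡i = sym d≡i
    ... | no d≢i  = ⊥-elim (proj₁ split _ _ ud∈E₁ (OnPath-edge (proj₁ (proj₂ hQi) (proj₂ ci))))
      where
      hQi : IsReprR E₂ i v (edge u d)
      hQi = subst (IsReprR E₂ i v)
                  (rQ≡repr hS ci λ ud∈p → d≢i (proj₂ (thin-OnPath thin (proj₁ ci) ud∈p))) (hQ i)

    rPd≡⊤ : rP d ≡ ⊤ₑ
    rPd≡⊤ = cong proj₁ (trans (sym (X-unique cd only-d)) X≡)

  prefix-meets-repr : ∀ {c d} → X ≡ (⊤ₑ , ⊤ₑ) → IsReprR E u v (edge c d) →
                      ¬ (∀ {i} (ci : Contributor i) → ¬ OnPath c d (proj₁ ci))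
  prefix-meets-repr X≡ hS h =
    ⊤ₑ⋢edge (subst (_⊑ _) (cong proj₂ X≡) (X₂-⊑ λ ci → ⊑-reflexive (rQ≡repr hS ci (h ci))))

  X≡⊤⊤⇒¬IsReprR-edge : ∀ {c d} → X ≡ (⊤ₑ , ⊤ₑ) → ¬ IsReprR E u v (edge c d)
  X≡⊤⊤⇒¬IsReprR-edge {c} {d} X≡ hS with c ≟ u | Contributor? d
  ... | no c≢u   | _      = prefix-meets-repr X≡ hS λ ci cd∈p →
                              c≢u (proj₁ (thin-OnPath thin (proj₁ ci) cd∈p))
  ... | yes refl | no ¬cd = prefix-meets-repr X≡ hS λ ci cd∈p →
                              ¬cd (subst Contributor (sym (proj₂ (thin-OnPath thin (proj₁ ci) cd∈p))) ci)
  ... | yes refl | yes cd = ¬IsReprR-first-edge X≡ hS cd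

  X≡⊤⊤⇒s≡⊤ : ∀ {s} → X ≡ (⊤ₑ , ⊤ₑ) → IsReprR E u v s → s ≡ ⊤ₑ
  X≡⊤⊤⇒s≡⊤ {⊤ₑ}       _  _  = refl
  X≡⊤⊤⇒s≡⊤ {⊥ₑ}       X≡ ¬r = case trans (sym X≡) (¬Path⇒X≡⊥ ¬r) of λ ()
  X≡⊤⊤⇒s≡⊤ {edge _ _} X≡ hS = ⊥-elim (X≡⊤⊤⇒¬IsReprR-edge X≡ hS)

  IsReprR-⊤⇒X≡⊤⊤ : IsReprR E u v ⊤ₑ → X ≡ (⊤ₑ , ⊤ₑ)
  IsReprR-⊤⇒X≡⊤⊤ (r , no-edge) = go X refl
    where
    go : ∀ z → X ≡ z → z ≡ (⊤ₑ , ⊤ₑ)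
    go (⊤ₑ , ⊤ₑ)       _  = refl
    go (⊥ₑ , _)        X≡ = ⊥-elim (X≡⊥ˡ⇒¬Path X≡ r)
    go (_ , ⊥ₑ)        X≡ = ⊥-elim (X≡⊥ʳ⇒¬Path X≡ r)
    go (_ , edge c d)  X≡ = ⊥-elim (no-edge c d (proj₁ (proj₂ (IsReprR-of-X₂ X≡))))
    go (edge a b , ⊤ₑ) X≡ = ⊥-elim (no-edge a b (proj₁ (proj₂ (IsReprR-of-X₁ X≡))))

lemma4 : (n : ℕ) (E₁ E₂ : EdgeSet n) →
    Topological (E₁ ∪ E₂) → EdgeSplit E₁ E₂ → Thin E₁ →
    (u v : Fin n) (rP rQ : Fin n → E⁺ n) (s : E⁺ n) →
    (∀ i → IsReprL E₁ u i (rP i)) →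
    (∀ i → IsReprR E₂ i v (rQ i)) →
    IsReprR (E₁ ∪ E₂) u v s →
    ((⨁ (λ i → rP i ⊗ rQ i) ≡ (⊥ₑ , ⊥ₑ)) ⇔ (s ≡ ⊥ₑ))
    × (∀ a b → ⨁ (λ i → rP i ⊗ rQ i) ≡ (edge a b , ⊤ₑ) → s ≡ edge a b)
    × (∀ a b → ⨁ (λ i → rP i ⊗ rQ i) ≡ (⊤ₑ , edge a b) → s ≡ edge a b)
    × (∀ a b c d → ⨁ (λ i → rP i ⊗ rQ i) ≡ (edge a b , edge c d) → s ≡ edge c d)
    × ((⨁ (λ i → rP i ⊗ rQ i) ≡ (⊤ₑ , ⊤ₑ)) ⇔ (s ≡ ⊤ₑ))
lemma4 n E₁ E₂ top split thin u v rP rQ s hP hQ hS =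
    mk⇔ (λ X≡ → IsReprR-¬Path hS (X≡⊥ˡ⇒¬Path X≡))
        (λ s≡⊥ → ¬Path⇒X≡⊥ (subst (IsReprR E u v) s≡⊥ hS))
  , (λ _ _ X≡ → IsReprR-unique top hS (IsReprR-of-X₁ X≡))
  , (λ _ _ X≡ → IsReprR-unique top hS (IsReprR-of-X₂ X≡))
  , (λ _ _ _ _ X≡ → IsReprR-unique top hS (IsReprR-of-X₂ X≡))
  , mk⇔ (λ X≡ → X≡⊤⊤⇒s≡⊤ X≡ hS)
        (λ s≡⊤ → IsReprR-⊤⇒X≡⊤⊤ (subst (IsReprR E u v) s≡⊤ hS))
  where open Contribution E₁ E₂ top split thin u v rP rQ hP hQ
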